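{- For every $0$-$1$ word $\mu$, every member of the age $\mathrm{Age}(G_\mu)$ is a permutation graph.
   Context: A word is a map $\mu$ into $\{0,1\}$ whose domain is $\{0,\dots,n-1\}$, $\mathbb N$, $\mathbb N^*=\{0,-1,-2,\dots\}$ or $\mathbb Z$. The graph $G_\mu$ has vertex set $\{ -1,0,\dots,n-1\}$ if the domain of $\mu$ is $\{0,\dots,n-1\}$, $\{ -1\}\cup\mathbb N$ if the domain is $\mathbb N$, and $\mathbb N^*$, resp. $\mathbb Z$, if the domain is $\mathbb N^*$, resp. $\mathbb Z$; for vertices $i<j$, $\{i,j\}$ is an edge iff either ($\mu_j=1$ and $j=i+1$) or ($\mu_j=0$ and $j\neq i+1$). $\mathrm{Age}(G)$ is the class of finite graphs, up to isomorphism, isomorphic to an induced subgraph of $G$. A finite graph $G=(V,E)$ is a permutation graph if there are a linear order $\le$ on $V$ and a permutation $\sigma$ of $V$ such that the edges of $G$ are exactly the pairs $\{x,y\}$ with $x<y$ and $\sigma(y)<\sigma(x)$. -}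

module Defs where

open import Data.Nat using (ℕ)
open import Data.Integer using (ℤ; +_; -[1+_]; _+_; _<_; _≤_)
open import Data.Bool using (Bool; true; false)
open import Data.Fin using (Fin)
open import Data.Fin.Permutation using (Permutation′; _⟨$⟩ʳ_)
open import Data.Product using (Σ; _×_; ∃; ∃-syntax; proj₁)
open import Data.Sum using (_⊎_)
open import Data.Unit using (⊤)
open import Relation.Nullary using (¬_)
open import Relation.Binary.PropositionalEquality using (_≡_; _≢_)
open import Relation.Binary.Structures using (IsStrictTotalOrder)
open import Function.Bundles using (_⇔_)

data Domain : Set where
  finite : ℕ → Domain   -- {0,…,n-1}
  nat    : Domain
  negnat : Domain       -- ℕ* = {0,-1,-2,…}
  int    : Domain

-- A word with domain D is represented by a map ℤ → Bool; only its values on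
-- the domain D are ever consulted by the graph G_μ.
Word : Set
Word = ℤ → Bool

IsVertex : Domain → ℤ → Set
IsVertex (finite n) i = (-[1+ 0 ] ≤ i) × (i < + n)
IsVertex nat        i = -[1+ 0 ] ≤ i
IsVertex negnat     i = i ≤ + 0
IsVertex int        i = ⊤

Vertex : Domain → Set
Vertex D = Σ ℤ (IsVertex D)

EdgeLt : Word → ℤ → ℤ → Set
EdgeLt μ i j = (μ j ≡ true × j ≡ i + + 1) ⊎ (μ j ≡ false × j ≢ i + + 1)

GAdj : (D : Domain) → Word → Vertex D → Vertex D → Set
GAdj D μ u v =
  (proj₁ u < proj₁ v × EdgeLt μ (proj₁ u) (proj₁ v)) ⊎
  (proj₁ v < proj₁ u × EdgeLt μ (proj₁ v) (proj₁ u))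

record FinGraph : Set₁ where
  field
    size   : ℕ
    Adj    : Fin size → Fin size → Set
    sym    : ∀ x y → Adj x y → Adj y x
    irrefl : ∀ x → ¬ Adj x x
open FinGraph public

InAge : (D : Domain) → Word → FinGraph → Set
InAge D μ H =
  Σ (Fin (size H) → Vertex D) λ f →
    (∀ x y → proj₁ (f x) ≡ proj₁ (f y) → x ≡ y) ×
    (∀ x y → Adj H x y ⇔ GAdj D μ (f x) (f y))

IsPermutationGraph : FinGraph → Set₁
IsPermutationGraph H =
  Σ (Fin (size H) → Fin (size H) → Set) λ _≺_ →
    IsStrictTotalOrder _≡_ _≺_ ×
    Σ (Permutation′ (size H)) λ σ → (∀ x y → Adj H x y ⇔
      ((x ≺ y × (σ ⟨$⟩ʳ y) ≺ (σ ⟨$⟩ʳ x)) ⊎ (y ≺ x × (σ ⟨$⟩ʳ x) ≺ (σ ⟨$⟩ʳ y))))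

-- Realise G_μ by two linear orders of ℤ, so that {s, t} is an edge exactly when the orders
-- disagree on s and t. Going up from a least vertex, each order places the next vertex t = u + 1
-- either immediately inside u or beyond all earlier vertices on one side, and the two orders swap
-- these roles at every step. The order that puts t beyond everything sees t on the side of u iff
-- μ_t = 1, so the orders disagree on {u, t} iff μ_t = 1 and on {s, t}, s < u, iff μ_t = 0: exactly
-- the edges of G_μ. Ranking a finite set of vertices in both orders then gives the linear order
-- and the permutation.
module Submission where

open import Level using (Level; 0ℓ)
open import Data.Bool using (Bool; true; false; not; _xor_; if_then_else_; T)
open import Data.Bool.Properties using (xor-comm)
open import Data.Empty using (⊥-elim)
open import Data.Fin as F using (Fin; zero; suc; punchIn; punchOut; fromℕ)
import Data.Fin.Properties as F
open import Data.Fin.Permutation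
  using (Permutation; Permutation′; _⟨$⟩ʳ_; id; insert; insert-punchIn; flip; _∘ₚ_; inverseʳ)
open import Data.Integer as ℤ using (ℤ; +_; +[1+_]; -[1+_]; +<+; -<+; -<-; +≤+; _-_; ∣_∣; _⊓_)
import Data.Integer.Properties as ℤ
open import Algebra.Properties.AbelianGroup ℤ.+-0-abelianGroup using (\\-leftDividesˡ; ∙-cancelˡ)
open import Data.Nat as ℕ using (ℕ; zero; suc; _*_; s≤s)
import Data.Nat.Properties as ℕ
open import Data.Product using (Σ; ∃-syntax; _×_; _,_; proj₁)
open import Data.Product.Function.NonDependent.Propositional using (_×-⇔_)
open import Data.Sum using (_⊎_; inj₁; inj₂; swap)
open import Data.Sum.Function.Propositional using (_⊎-⇔_)
open import Data.Unit using (tt)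
open import Function using (_∘_; _on_)
open import Function.Bundles using (_⇔_; mk⇔; Equivalence; Injection)
open import Function.Properties.Inverse using (↔⇒↣)
open import Function.Construct.Composition using (_⇔-∘_)
open import Function.Construct.Symmetry using (⇔-sym)
open import Function.Definitions using (Injective)
open import Relation.Binary.Bundles using (StrictTotalOrder)
open import Relation.Binary.Core using (Rel)
open import Relation.Binary.Definitions using (Asymmetric; Irreflexive; Trichotomous; tri<; tri≈; tri>)
open import Relation.Binary.PropositionalEquality as ≡ using (_≡_; _≢_; refl)
open import Relation.Binary.Structures using (IsStrictTotalOrder)
open import Relation.Nullary using (¬_; Dec; yes; no; does)
import Relation.Nullary.Decidable as Decidable
open Decidable using (dec-true; dec-false)

open import Defs using (Domain; Word; EdgeLt; FinGraph; size; Adj; InAge; IsPermutationGraph)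

private
  variable
    a ℓ ℓ′ : Level
    A B : Set a

Discordant : Rel A ℓ → A → A → A → A → Set ℓ
Discordant _<_ x y x′ y′ = (x < y × y′ < x′) ⊎ (y < x × x′ < y′)

discordant-irrefl : {_<_ : Rel A ℓ} → Irreflexive _≡_ _<_ →
                    {x x′ : A} → ¬ Discordant _<_ x x x′ x′
discordant-irrefl irrefl (inj₁ (x<x , _)) = irrefl refl x<x
discordant-irrefl irrefl (inj₂ (x<x , _)) = irrefl refl x<x

discordant-⇔ : {_<_ : Rel A ℓ} {_⊏_ : Rel B ℓ′} {x y x′ y′ : A} {u v u′ v′ : B} →
               (x < y) ⇔ (u ⊏ v) → (y < x) ⇔ (v ⊏ u) →
               (x′ < y′) ⇔ (u′ ⊏ v′) → (y′ < x′) ⇔ (v′ ⊏ u′) →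
               Discordant _<_ x y x′ y′ ⇔ Discordant _⊏_ u v u′ v′
discordant-⇔ xy yx x′y′ y′x′ = (xy ×-⇔ y′x′) ⊎-⇔ (yx ×-⇔ x′y′)

Towards : Rel A ℓ → Bool → A → A → Set ℓ
Towards _<_ true  x y = x < y
Towards _<_ false x y = y < x

towards⇒≢ : {_<_ : Rel A ℓ} → Irreflexive _≡_ _<_ →
            ∀ c {x y} → Towards _<_ c x y → x ≢ y
towards⇒≢ irrefl true  x<y x≡y = irrefl x≡y x<y
towards⇒≢ irrefl false y<x x≡y = irrefl (≡.sym x≡y) y<x

discordant⇔xor : {_<_ : Rel A ℓ} → Asymmetric _<_ → ∀ c c′ {x y x′ y′} →
                 Towards _<_ c x y → Towards _<_ c′ x′ y′ →
                 Discordant _<_ x y x′ y′ ⇔ T (c xor c′)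
discordant⇔xor asym true  true  x<y x′<y′ =
  mk⇔ (λ { (inj₁ (_ , y′<x′)) → asym x′<y′ y′<x′ ; (inj₂ (y<x , _)) → asym x<y y<x }) λ ()
discordant⇔xor asym true  false x<y y′<x′ = mk⇔ (λ _ → tt) (λ _ → inj₁ (x<y , y′<x′))
discordant⇔xor asym false true  y<x x′<y′ = mk⇔ (λ _ → tt) (λ _ → inj₂ (y<x , x′<y′))
discordant⇔xor asym false false y<x y′<x′ =
  mk⇔ (λ { (inj₁ (x<y , _)) → asym x<y y<x ; (inj₂ (_ , x′<y′)) → asym x′<y′ y′<x′ }) λ ()

isStrictTotalOrder-onInjective : {_<_ : Rel A ℓ} (f : B → A) → Injective _≡_ _≡_ f →
                                 IsStrictTotalOrder _≡_ _<_ → IsStrictTotalOrder _≡_ (_<_ on f)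
isStrictTotalOrder-onInjective {_<_ = _<_} f f-injective sto = record
  { isStrictPartialOrder = record
    { isEquivalence = ≡.isEquivalence
    ; irrefl        = λ { refl → S.irrefl refl }
    ; trans         = S.trans
    ; <-resp-≈      = (λ { refl lt → lt }) , (λ { refl lt → lt })
    }
  ; compare = compare-on
  }
  where
  module S = IsStrictTotalOrder sto
  compare-on : Trichotomous _≡_ (_<_ on f)
  compare-on x y with S.compare (f x) (f y)
  ... | tri< lt ≢ ≯ = tri< lt (≢ ∘ ≡.cong f) ≯
  ... | tri≈ ≮ eq ≯ = tri≈ ≮ (f-injective eq) ≯
  ... | tri> ≮ ≢ gt = tri> ≮ (≢ ∘ ≡.cong f) gt

insert-self : ∀ {m n} (i : Fin (suc m)) (j : Fin (suc n)) (π : Permutation m n) →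
              insert i j π ⟨$⟩ʳ i ≡ j
insert-self i j π with i F.≟ i
... | yes _   = refl
... | no  i≢i = ⊥-elim (i≢i refl)

data PunchView {n} (i : Fin (suc n)) : Fin (suc n) → Set where
  at     : PunchView i i
  beside : ∀ j → PunchView i (punchIn i j)

punchView : ∀ {n} (i x : Fin (suc n)) → PunchView i x
punchView i x with i F.≟ x
... | yes refl = at
... | no  i≢x  = ≡.subst (PunchView i) (F.punchIn-punchOut i≢x) (beside (punchOut i≢x))

punchIn-mono-< : ∀ {n} (i : Fin (suc n)) {j k : Fin n} → j F.< k → punchIn i j F.< punchIn i k
punchIn-mono-< i {j} {k} j<k =
  F.≤∧≢⇒< (F.punchIn-mono-≤ i j k (ℕ.<⇒≤ j<k)) (λ e → F.<-irrefl (F.punchIn-injective i j k e) j<k)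

module _ {c ℓ₁ ℓ₂} (O : StrictTotalOrder c ℓ₁ ℓ₂) where

  open StrictTotalOrder O
    using (_<_; _≈_; compare; irrefl; asym; trans; <-respˡ-≈; module Eq) renaming (Carrier to X)

  argmax : ∀ {n} (k : Fin (suc n) → X) → ∃[ i ] (∀ j → ¬ k i < k j)
  argmax {zero} k = zero , λ { zero → irrefl Eq.refl }
  argmax {suc n} k with argmax (k ∘ suc)
  ... | i , max with compare (k zero) (k (suc i))
  ... | tri< k₀<kᵢ _ _ = suc i , λ { zero → asym k₀<kᵢ ; (suc j) → max j }
  ... | tri≈ _ k₀≈kᵢ _ = zero , λ { zero → irrefl Eq.refl ; (suc j) → max j ∘ <-respˡ-≈ k₀≈kᵢ }
  ... | tri> _ _ kᵢ<k₀ = zero , λ { zero → irrefl Eq.refl ; (suc j) → max j ∘ trans kᵢ<k₀ }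

  -- Insertion sort: a maximum of k goes to the last place, the rest is sorted recursively.
  monotonePermutation : ∀ {n} (k : Fin n → X) → Injective _≡_ _≈_ k →
                        Σ (Permutation′ n) λ π → (∀ x y → k x < k y → π ⟨$⟩ʳ x F.< π ⟨$⟩ʳ y)
  monotonePermutation {zero} k _ = id , λ ()
  monotonePermutation {suc n} k k-injective with argmax k
  ... | i , max with monotonePermutation (k ∘ punchIn i) (F.punchIn-injective i _ _ ∘ k-injective)
  ... | π , π-mono = ρ , ρ-mono
    where
    ρ = insert i (fromℕ n) π
    ρ-mono : ∀ x y → k x < k y → ρ ⟨$⟩ʳ x F.< ρ ⟨$⟩ʳ y
    ρ-mono x y kx<ky with punchView i x | punchView i y
    ... | at       | _        = ⊥-elim (max y kx<ky)
    ... | beside j | at       =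
      ≡.subst₂ F._<_ (≡.sym (insert-punchIn i (fromℕ n) π j)) (≡.sym (insert-self i (fromℕ n) π))
        (F.≤∧≢⇒< (F.≤fromℕ _) (F.punchInᵢ≢i (fromℕ n) (π ⟨$⟩ʳ j)))
    ... | beside j | beside j′ =
      ≡.subst₂ F._<_ (≡.sym (insert-punchIn i (fromℕ n) π j)) (≡.sym (insert-punchIn i (fromℕ n) π j′))
        (punchIn-mono-< (fromℕ n) (π-mono j j′ kx<ky))

  sortingPermutation : ∀ {n} (k : Fin n → X) → Injective _≡_ _≈_ k →
                       Σ (Permutation′ n) λ π → (∀ x y → (k x < k y) ⇔ (π ⟨$⟩ʳ x F.< π ⟨$⟩ʳ y))
  sortingPermutation k k-injective with monotonePermutation k k-injective
  ... | π , π-mono = π , λ x y → mk⇔ (π-mono x y) (reflect x y)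
    where
    reflect : ∀ x y → π ⟨$⟩ʳ x F.< π ⟨$⟩ʳ y → k x < k y
    reflect x y πx<πy with compare (k x) (k y)
    ... | tri< kx<ky _ _ = kx<ky
    ... | tri≈ _ kx≈ky _ = ⊥-elim (F.<-irrefl (≡.cong (π ⟨$⟩ʳ_) (k-injective kx≈ky)) πx<πy)
    ... | tri> _ _ ky<kx = ⊥-elim (F.<-asym πx<πy (π-mono y x ky<kx))

  realisable⇒isPermutationGraph :
    (H : FinGraph) (k₁ k₂ : Fin (size H) → X) → Injective _≡_ _≈_ k₁ → Injective _≡_ _≈_ k₂ →
    (∀ x y → Adj H x y ⇔ Discordant _<_ (k₁ x) (k₁ y) (k₂ x) (k₂ y)) → IsPermutationGraph H
  realisable⇒isPermutationGraph H k₁ k₂ k₁-injective k₂-injective realises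
    with sortingPermutation k₁ k₁-injective | sortingPermutation k₂ k₂-injective
  ... | r₁ , r₁-sorts | r₂ , r₂-sorts =
    _≺_ , ≺-isStrictTotalOrder , σ , adjacency
    where
    _≺_ : Rel (Fin (size H)) 0ℓ
    _≺_ = F._<_ on (r₁ ⟨$⟩ʳ_)

    ≺-isStrictTotalOrder : IsStrictTotalOrder _≡_ _≺_
    ≺-isStrictTotalOrder =
      isStrictTotalOrder-onInjective (r₁ ⟨$⟩ʳ_) (Injection.injective (↔⇒↣ r₁)) F.<-isStrictTotalOrder

    σ : Permutation′ (size H)
    σ = r₂ ∘ₚ flip r₁

    adjacency : ∀ x y → Adj H x y ⇔ Discordant _≺_ x y (σ ⟨$⟩ʳ x) (σ ⟨$⟩ʳ y)
    adjacency x y =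
      ≡.subst₂ (λ u v → Adj H x y ⇔ Discordant F._<_ (r₁ ⟨$⟩ʳ x) (r₁ ⟨$⟩ʳ y) u v)
             (≡.sym (inverseʳ r₁)) (≡.sym (inverseʳ r₁))
        (discordant-⇔ {_<_ = _<_} {_⊏_ = F._<_}
                      (r₁-sorts x y) (r₁-sorts y x) (r₂-sorts x y) (r₂-sorts y x)
         ⇔-∘ realises x y)

signed : Bool → ℕ → ℤ
signed true  a = +[1+ a ]
signed false a = -[1+ a ]

signed-beyond : ∀ c c′ {a a′} → a ℕ.< a′ → Towards ℤ._<_ c (signed c′ a) (signed c a′)
signed-beyond true  true  a<a′ = +<+ (s≤s a<a′)
signed-beyond true  false _    = -<+
signed-beyond false true  _    = -<+
signed-beyond false false a<a′ = -<- a<a′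

signed-within : ∀ c {a a′} → a ℕ.< a′ → Towards ℤ._<_ (not c) (signed c a′) (signed c a)
signed-within true  a<a′ = +<+ (s≤s a<a′)
signed-within false a<a′ = -<- a<a′

xor-cancelʳ : ∀ x y z → (x xor z) xor (y xor z) ≡ x xor y
xor-cancelʳ false false false = refl
xor-cancelʳ false false true  = refl
xor-cancelʳ false true  false = refl
xor-cancelʳ false true  true  = refl
xor-cancelʳ true  false false = refl
xor-cancelʳ true  false true  = refl
xor-cancelʳ true  true  false = refl
xor-cancelʳ true  true  true  = refl

xor-decision : {P : Set ℓ} (P? : Dec P) (c : Bool) →
               ((c ≡ true × P) ⊎ (c ≡ false × ¬ P)) ⇔ T (does P? xor not c)
xor-decision (yes p) true  = mk⇔ (λ _ → tt) (λ _ → inj₁ (refl , p))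
xor-decision (yes p) false = mk⇔ (λ { (inj₁ (() , _)) ; (inj₂ (_ , ¬p)) → ¬p p }) λ ()
xor-decision (no ¬p) true  = mk⇔ (λ { (inj₁ (_ , p)) → ¬p p ; (inj₂ (() , _)) }) λ ()
xor-decision (no ¬p) false = mk⇔ (λ _ → tt) (λ _ → inj₂ (refl , ¬p))

module Realisation (μ : Word) (m : ℤ) where

  vertex : ℕ → ℤ
  vertex p = m ℤ.+ + p

  offset : ℤ → ℕ
  offset v = ∣ v - m ∣

  vertex-mono-< : ∀ {p q} → p ℕ.< q → vertex p ℤ.< vertex q
  vertex-mono-< p<q = ℤ.+-monoʳ-< m (+<+ p<q)

  vertex-cancel-< : ∀ {p q} → vertex p ℤ.< vertex q → p ℕ.< q
  vertex-cancel-< vp<vq = ℕ.≰⇒> (λ q≤p → ℤ.<⇒≱ vp<vq (ℤ.+-monoʳ-≤ m (+≤+ q≤p)))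

  vertex-injective : ∀ {p q} → vertex p ≡ vertex q → p ≡ q
  vertex-injective = ℤ.+-injective ∘ ∙-cancelˡ m _ _

  vertex-suc : ∀ p → vertex p ℤ.+ + 1 ≡ vertex (suc p)
  vertex-suc p = ≡.trans (ℤ.+-assoc m (+ p) (+ 1)) (≡.cong (λ q → m ℤ.+ + q) (ℕ.+-comm p 1))

  vertex-suc⇔ : ∀ s u → (vertex (suc u) ≡ vertex s ℤ.+ + 1) ⇔ (s ≡ u)
  vertex-suc⇔ s u =
    mk⇔ (λ e → ≡.sym (ℕ.suc-injective (vertex-injective (≡.trans e (vertex-suc s)))))
        (λ { refl → ≡.sym (vertex-suc s) })

  vertex-offset : ∀ {v} → m ℤ.≤ v → vertex (offset v) ≡ v
  vertex-offset {v} m≤v = begin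
    m ℤ.+ + ∣ v - m ∣   ≡⟨ ≡.cong (ℤ._+_ m) (ℤ.0≤i⇒+∣i∣≡i (ℤ.i≤j⇒0≤j-i m≤v)) ⟩
    m ℤ.+ (v - m)       ≡⟨ ≡.cong (ℤ._+_ m) (ℤ.+-comm v (ℤ.- m)) ⟩
    m ℤ.+ (ℤ.- m ℤ.+ v) ≡⟨ \\-leftDividesˡ m v ⟩
    v                   ∎
    where open ≡.≡-Reasoning

  side : ℕ → Bool
  side zero    = true
  side (suc u) = not (μ (vertex (suc u))) xor side u

  -- Order b puts vertex u + 1 immediately inside u (on u's side, depth 2u against u's 2u + 1)
  -- when tight b u, and otherwise beyond all earlier vertices on side (u + 1), at depth
  -- 2(u + 1) + 1; every earlier vertex s has depth at most 2s + 1. The two orders take turns.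
  tight : Bool → ℕ → Bool
  tight b zero    = b
  tight b (suc u) = not (tight b u)

  orientation : Bool → ℕ → Bool
  orientation b zero    = true
  orientation b (suc u) = if tight b u then side u else side (suc u)

  depth : Bool → ℕ → ℕ
  depth b zero    = 1
  depth b (suc u) = if tight b u then 2 * u else suc (2 * suc u)

  position : Bool → ℕ → ℤ
  position b t = signed (orientation b t) (depth b t)

  Disagree : ℕ → ℕ → Set
  Disagree p q =
    Discordant ℤ._<_ (position false p) (position false q) (position true p) (position true q)

  depth-bound : ∀ b s → depth b s ℕ.≤ suc (2 * s)
  depth-bound b zero    = ℕ.≤-refl
  depth-bound b (suc u) with tight b u
  ... | true  = ℕ.≤-trans (ℕ.*-monoʳ-≤ 2 (ℕ.n≤1+n u)) (ℕ.n≤1+n _)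
  ... | false = ℕ.≤-refl

  tight⇒position : ∀ b u → tight b u ≡ true → position b u ≡ signed (side u) (suc (2 * u))
  tight⇒position b zero    _ = refl
  tight⇒position b (suc w) _  with tight b w
  tight⇒position b (suc w) () | true
  tight⇒position b (suc w) _  | false = refl

  stepDirection : Bool → ℕ → ℕ → Bool
  stepDirection b s u = if tight b u then does (s ℕ.≟ u) xor side u else side (suc u)

  position-step : ∀ b {s u} → s ℕ.< suc u →
                  Towards ℤ._<_ (stepDirection b s u) (position b s) (position b (suc u))
  position-step b {s} {u} s<t with tight b u in tight≡
  ... | false = signed-beyond (side (suc u)) (orientation b s)
                  (ℕ.≤-<-trans (depth-bound b s) (s≤s (ℕ.*-monoʳ-< 2 s<t)))
  ... | true with s ℕ.≟ u
  ...   | yes refl rewrite dec-true (u ℕ.≟ u) refl | tight⇒position b u tight≡ =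
          signed-within (side u) (ℕ.n<1+n (2 * u))
  ...   | no  s≢u  rewrite dec-false (s ℕ.≟ u) s≢u =
          signed-beyond (side u) (orientation b s) (ℕ.≤-<-trans (depth-bound b s) 2s+1<2u)
    where
    2s+1<2u : suc (2 * s) ℕ.< 2 * u
    2s+1<2u = ≡.subst (ℕ._≤ 2 * u) (ℕ.*-suc 2 s) (ℕ.*-monoʳ-≤ 2 (ℕ.≤∧≢⇒< (ℕ.≤-pred s<t) s≢u))

  position-injective : ∀ b {s t} → position b s ≡ position b t → s ≡ t
  position-injective b {s} {t} e with ℕ.<-cmp s t
  position-injective b {s} {suc u} e | tri< s<t _ _ =
    ⊥-elim (towards⇒≢ ℤ.<-irrefl (stepDirection b s u) (position-step b s<t) e)
  ... | tri≈ _ s≡t _ = s≡t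
  position-injective b {suc u} {t} e | tri> _ _ t<s =
    ⊥-elim (towards⇒≢ ℤ.<-irrefl (stepDirection b t u) (position-step b t<s) (≡.sym e))

  tight-false : ∀ u → tight false u ≡ not (tight true u)
  tight-false zero    = refl
  tight-false (suc u) = ≡.cong not (tight-false u)

  stepDirection-xor : ∀ s u → stepDirection false s u xor stepDirection true s u ≡
                              does (s ℕ.≟ u) xor not (μ (vertex (suc u)))
  stepDirection-xor s u rewrite tight-false u with tight true u
  ... | true  = ≡.trans (xor-cancelʳ (not (μ (vertex (suc u)))) (does (s ℕ.≟ u)) (side u))
                        (xor-comm (not (μ (vertex (suc u)))) (does (s ℕ.≟ u)))
  ... | false = xor-cancelʳ (does (s ℕ.≟ u)) (not (μ (vertex (suc u)))) (side u)

  edge⇔xor : ∀ s u → EdgeLt μ (vertex s) (vertex (suc u)) ⇔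
                     T (stepDirection false s u xor stepDirection true s u)
  edge⇔xor s u rewrite stepDirection-xor s u =
    xor-decision (Decidable.map (⇔-sym (vertex-suc⇔ s u)) (s ℕ.≟ u)) (μ (vertex (suc u)))

  edge⇔disagree : ∀ {s t} → s ℕ.< t → EdgeLt μ (vertex s) (vertex t) ⇔ Disagree s t
  edge⇔disagree {s} {suc u} s<t =
    ⇔-sym (discordant⇔xor ℤ.<-asym (stepDirection false s u) (stepDirection true s u)
                            (position-step false s<t) (position-step true s<t))
    ⇔-∘ edge⇔xor s u

  Adjacent : ℤ → ℤ → Set
  Adjacent i j = (i ℤ.< j × EdgeLt μ i j) ⊎ (j ℤ.< i × EdgeLt μ j i)

  vertex-adjacent⇔disagree : ∀ p q → Adjacent (vertex p) (vertex q) ⇔ Disagree p q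
  vertex-adjacent⇔disagree p q = mk⇔ to from
    where
    to : Adjacent (vertex p) (vertex q) → Disagree p q
    to (inj₁ (vp<vq , e)) = Equivalence.to (edge⇔disagree (vertex-cancel-< vp<vq)) e
    to (inj₂ (vq<vp , e)) = swap (Equivalence.to (edge⇔disagree (vertex-cancel-< vq<vp)) e)
    from : Disagree p q → Adjacent (vertex p) (vertex q)
    from d with ℕ.<-cmp p q
    ... | tri< p<q _ _  = inj₁ (vertex-mono-< p<q , Equivalence.from (edge⇔disagree p<q) d)
    ... | tri≈ _ refl _ = ⊥-elim (discordant-irrefl ℤ.<-irrefl d)
    ... | tri> _ _ q<p  = inj₂ (vertex-mono-< q<p , Equivalence.from (edge⇔disagree q<p) (swap d))

  adjacent⇔disagree : ∀ {i j} → m ℤ.≤ i → m ℤ.≤ j → Adjacent i j ⇔ Disagree (offset i) (offset j)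
  adjacent⇔disagree {i} {j} m≤i m≤j =
    ≡.subst₂ (λ i′ j′ → Adjacent i′ j′ ⇔ Disagree (offset i) (offset j))
             (vertex-offset m≤i) (vertex-offset m≤j) (vertex-adjacent⇔disagree (offset i) (offset j))

  offset-injective : ∀ {i j} → m ℤ.≤ i → m ℤ.≤ j → offset i ≡ offset j → i ≡ j
  offset-injective m≤i m≤j e =
    ≡.trans (≡.sym (vertex-offset m≤i)) (≡.trans (≡.cong vertex e) (vertex-offset m≤j))

lowerBound : ∀ {n} → (Fin n → ℤ) → ℤ
lowerBound {zero}  g = + 0
lowerBound {suc n} g = g zero ⊓ lowerBound (g ∘ suc)

lowerBound-≤ : ∀ {n} (g : Fin n → ℤ) i → lowerBound g ℤ.≤ g i
lowerBound-≤ g zero    = ℤ.i⊓j≤i _ _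
lowerBound-≤ g (suc i) = ℤ.≤-trans (ℤ.i⊓j≤j _ _) (lowerBound-≤ (g ∘ suc) i)

-- The domain D is never consulted: the realisation works for any finite set of integers.
mainTheorem8 : (D : Domain) (μ : Word) (H : FinGraph) → InAge D μ H → IsPermutationGraph H
mainTheorem8 _ μ H (f , f-injective , f-adjacency) =
  realisable⇒isPermutationGraph ℤ.<-strictTotalOrder H
    (k false) (k true) (k-injective false) (k-injective true)
    (λ x y → adjacent⇔disagree (bounded x) (bounded y) ⇔-∘ f-adjacency x y)
  where
  v : Fin (size H) → ℤ
  v x = proj₁ (f x)

  open Realisation μ (lowerBound v)

  bounded : ∀ x → lowerBound v ℤ.≤ v x
  bounded = lowerBound-≤ v

  k : Bool → Fin (size H) → ℤ
  k b x = position b (offset (v x))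

  k-injective : ∀ b → Injective _≡_ _≡_ (k b)
  k-injective b e = f-injective _ _ (offset-injective (bounded _) (bounded _) (position-injective b e))
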